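{- Let $N\ge1$, let $p$ be an odd prime, let $n\in\mathbb{Z}$, $\lambda\in\mathbb{Z}^N$, and put $\Delta=4n-(\lambda_1^2+\dots+\lambda_N^2)$. For every $l\in\mathbb{N}$, \[\mathfrak{D}_{p^l}(\lambda,-\Delta,NA_1)=\frac{\omega(\lambda)}{\alpha(\lambda)}\,A_N(-\Delta,p^l),\] where $A_N(-\Delta,p^l)=\#\{x\bmod(p^l\mathbb{Z})^N\,;\,x_1^2+\dots+x_N^2\equiv-\Delta\bmod p^l\}$, \[\alpha(\lambda)=\#\Big\{\sigma\in\{0,1\}^N\,;\,\sum_{i\notin J(\lambda)}\sigma_i\equiv\sum_{i\in J(\lambda)}\sigma_i\pmod 4\Big\},\qquad J(\lambda)=\{i\in\{1,\dots,N\}\,;\,\lambda_i\equiv0\bmod 2\},\] and \[\omega(\lambda)=\sum_{\substack{0\le j\le N\\ j\equiv-\Delta\bmod 4}}\binom{N}{j}.\]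
   Context: $NA_1$ is the lattice $\mathbb{Z}^N$ with Gram matrix $S=2I_N$, so $(x,y)=2\sum x_iy_i$ and the quadratic form is $q(y)=\frac12(y,y)=y_1^2+\dots+y_N^2$; thus $\Delta=4n-\frac12(\lambda,\lambda)$. For $a\in\mathbb{N}$, $\mathfrak{D}_a(\lambda,\Delta',NA_1)=\#\{x\bmod(a\mathbb{Z})^N\,;\,q(2x-\lambda)\equiv\Delta'\bmod 4a\}$. -}

module Defs where

open import Data.Nat as ℕ using (ℕ; zero; suc; _^_)
open import Data.Nat.Combinatorics using (_C_)
open import Data.Integer as ℤ using (ℤ; +_; _-_; ∣_∣)
open import Data.Integer.Divisibility using (_∣_)
open import Data.Nat.Divisibility using (_∣?_)
open import Data.Fin using (Fin)
open import Data.Vec using (Vec; []; _∷_; zipWith; foldr)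
open import Data.List using (List; []; _∷_; _++_; map; concatMap; filter; length; upTo)
open import Data.Nat.ListAction using (sum)
open import Data.Bool using (Bool; true; false; if_then_else_)
open import Relation.Nullary using (Dec; ¬?)
open import Relation.Unary using (Pred; Decidable)

-- all vectors in {0,…,m-1}^N, i.e. representatives of (ℤ/mℤ)^N
allVecs : (m N : ℕ) → List (Vec ℕ N)
allVecs m zero = [] ∷ []
allVecs m (suc N) = concatMap (λ k → map (k ∷_) (allVecs m N)) (upTo m)

_≡_[mod_] : ℤ → ℤ → ℕ → Set
a ≡ b [mod m ] = + m ∣ (a - b)

_≡?_[mod_] : (a b : ℤ) (m : ℕ) → Dec (a ≡ b [mod m ])
a ≡? b [mod m ] = m ∣? ∣ a - b ∣

sumℤ : ∀ {N} → Vec ℤ N → ℤ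
sumℤ = foldr _ ℤ._+_ (+ 0)

q : ∀ {N} → Vec ℤ N → ℤ
q = foldr _ (λ y s → y ℤ.* y ℤ.+ s) (+ 0)

Δ : ∀ {N} → ℤ → Vec ℤ N → ℤ
Δ n λ' = + 4 ℤ.* n - q λ'

𝔇 : ∀ {N} → ℕ → Vec ℤ N → ℤ → ℕ
𝔇 {N} a λ' Δ' =
  length (filter (λ x → q (zipWith (λ xi li → + 2 ℤ.* + xi - li) x λ') ≡? Δ' [mod 4 ℕ.* a ])
                 (allVecs a N))

A : (N : ℕ) → ℤ → ℕ → ℕ
A N m a = length (filter (λ x → q (Data.Vec.map +_ x) ≡? m [mod a ]) (allVecs a N))

evenℤ? : (z : ℤ) → Dec (z ≡ + 0 [mod 2 ])
evenℤ? z = z ≡? + 0 [mod 2 ]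

sumInJ : ∀ {N} → Vec ℤ N → Vec ℕ N → ℕ
sumInJ [] [] = 0
sumInJ (l ∷ ls) (s ∷ ss) = (if Relation.Nullary.does (evenℤ? l) then s else 0) ℕ.+ sumInJ ls ss

sumNotInJ : ∀ {N} → Vec ℤ N → Vec ℕ N → ℕ
sumNotInJ [] [] = 0
sumNotInJ (l ∷ ls) (s ∷ ss) = (if Relation.Nullary.does (evenℤ? l) then 0 else s) ℕ.+ sumNotInJ ls ss

α : ∀ {N} → Vec ℤ N → ℕ
α {N} λ' = length (filter (λ σ → (+ (sumNotInJ λ' σ)) ≡? (+ (sumInJ λ' σ)) [mod 4 ]) (allVecs 2 N))

ω : (N : ℕ) → ℤ → ℕ
ω N D = sum (map (N C_) (filter (λ j → (+ j) ≡? ℤ.- D [mod 4 ]) (upTo (suc N))))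

{-# OPTIONS --safe #-}
module Submission where

-- The theorem is the product of α(λ) = ω(λ) and 𝔇_a(λ, −Δ) = A_N(−Δ, a) for odd a = p^l.
-- Splitting off σ₁ shows that the number of σ ∈ {0,1}^N with Σ_{i∉J} σᵢ ≡ Σ_{i∈J} σᵢ + t (mod m)
-- obeys Pascal's rule, so it is the sum of the C(N, j) with j ≡ t + #J; reflecting j ↦ N − j and
-- using λᵢ² ≡ 1 − [λᵢ even] (mod 4), i.e. q(λ) ≡ N − #J ≡ −Δ, turns α(λ) into ω(λ).
-- As −Δ ≡ q(λ) (mod 4), the congruence q(2x − λ) ≡ −Δ (mod 4a) only matters modulo the odd a,
-- and coordinatewise x ↦ 2x − λᵢ permutes ℤ/a, so 𝔇_a counts the same residues as A_N.

open import Defs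
open import Data.Bool using (true; false; if_then_else_)
open import Data.Bool.Properties using (if-eta)
open import Data.Empty using (⊥-elim)
open import Data.Integer as ℤ using (ℤ; +_; -[1+_]; -_; 0ℤ; 1ℤ; -1ℤ; ∣_∣)
import Data.Integer.Properties as ℤ
open import Data.Integer.DivMod using (a≡a%n+[a/n]*n; n%d<d)
open import Data.Integer.Divisibility.Signed
  using (_∣_; divides; ∣ᵤ⇒∣; ∣⇒∣ᵤ; ∣m∣n⇒∣m+n; ∣m∣n⇒∣m-n; ∣m⇒∣-m)
open import Data.Integer.Tactic.RingSolver using (solve-∀)
open import Data.List using ([]; _∷_; _++_; map; concatMap; filter; length; upTo; applyUpTo)
open import Data.List.Properties using (filter-++; length-++)
open import Data.Nat using (ℕ; zero; suc; _+_; _*_; _^_; _<_; _≥_; s≤s)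
open import Data.Nat.Combinatorics using (_C_; nCk+nC[k+1]≡[n+1]C[k+1]; k>n⇒nCk≡0)
import Data.Nat.Divisibility as ℕᵈ
open import Data.Nat.DivMod using (_%_; _/_; m≡m%n+[m/n]*n; m%n<n)
open import Data.Nat.ListAction using (sum)
open import Data.Nat.Primality using (Prime; prime⇒irreducible)
import Data.Nat.Properties as ℕ
import Data.Nat.Tactic.RingSolver as ℕ-Ring
open import Data.Product using (∃-syntax; _,_)
open import Data.Sum using (inj₁; inj₂)
open import Data.Vec using (Vec; []; _∷_; zipWith)
import Data.Vec as Vec
open import Function using (_∘_; id; _⇔_; mk⇔)
open import Level using (0ℓ)
open import Relation.Binary.PropositionalEquality
  using (_≡_; _≢_; refl; sym; trans; cong; cong₂; subst; _≗_; module ≡-Reasoning)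
open import Relation.Nullary using (Dec; yes; no; does)
open import Relation.Nullary.Decidable using (does-⇔)
open import Relation.Unary using (Pred; Decidable)

open ≡-Reasoning

sumBelow : ℕ → (ℕ → ℕ) → ℕ
sumBelow zero    f = 0
sumBelow (suc n) f = f 0 + sumBelow n (f ∘ suc)

sum-map-applyUpTo : ∀ (f g : ℕ → ℕ) n → sum (map f (applyUpTo g n)) ≡ sumBelow n (f ∘ g)
sum-map-applyUpTo f g zero    = refl
sum-map-applyUpTo f g (suc n) = cong (_+_ (f (g 0))) (sum-map-applyUpTo f (g ∘ suc) n)

sumBelow-cong : ∀ n {f g : ℕ → ℕ} → f ≗ g → sumBelow n f ≡ sumBelow n g
sumBelow-cong zero    f≗g = refl
sumBelow-cong (suc n) f≗g = cong₂ _+_ (f≗g 0) (sumBelow-cong n (f≗g ∘ suc))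

sumBelow-+ : ∀ n (f g : ℕ → ℕ) → sumBelow n (λ k → f k + g k) ≡ sumBelow n f + sumBelow n g
sumBelow-+ zero    f g = refl
sumBelow-+ (suc n) f g =
  trans (cong (_+_ (f 0 + g 0)) (sumBelow-+ n (f ∘ suc) (g ∘ suc)))
        (interchange (f 0) (g 0) (sumBelow n (f ∘ suc)) (sumBelow n (g ∘ suc)))
  where
  interchange : ∀ a b c d → a + b + (c + d) ≡ a + c + (b + d)
  interchange = ℕ-Ring.solve-∀

sumBelow-sucʳ : ∀ n (f : ℕ → ℕ) → sumBelow (suc n) f ≡ sumBelow n f + f n
sumBelow-sucʳ zero    f = ℕ.+-comm (f 0) 0
sumBelow-sucʳ (suc n) f =
  trans (cong (_+_ (f 0)) (sumBelow-sucʳ n (f ∘ suc))) (sym (ℕ.+-assoc (f 0) _ _))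

sumBelow-+-range : ∀ m n (f : ℕ → ℕ) → sumBelow (m + n) f ≡ sumBelow m f + sumBelow n (λ k → f (m + k))
sumBelow-+-range zero    n f = refl
sumBelow-+-range (suc m) n f =
  trans (cong (_+_ (f 0)) (sumBelow-+-range m n (f ∘ suc))) (sym (ℕ.+-assoc (f 0) _ _))

sumBelow-evenOdd : ∀ m (f : ℕ → ℕ) →
  sumBelow (suc (m + m)) f ≡ sumBelow (suc m) (λ k → f (k + k)) + sumBelow m (λ k → f (suc (k + k)))
sumBelow-evenOdd zero    f = sym (ℕ.+-identityʳ (f 0 + 0))
sumBelow-evenOdd (suc m) f = begin
    sumBelow (suc (suc m + suc m)) f
  ≡⟨ cong (λ i → sumBelow (suc (suc i)) f) (ℕ.+-suc m m) ⟩
    sumBelow (suc (suc (suc (m + m)))) f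
  ≡⟨ trans (sumBelow-sucʳ _ f) (cong (_+ f (2 + (m + m))) (sumBelow-sucʳ _ f)) ⟩
    sumBelow (suc (m + m)) f + f (1 + (m + m)) + f (2 + (m + m))
  ≡⟨ cong (λ s → s + f (1 + (m + m)) + f (2 + (m + m))) (sumBelow-evenOdd m f) ⟩
    E + O + f (1 + (m + m)) + f (2 + (m + m))
  ≡⟨ regroup E O _ _ ⟩
    (E + f (2 + (m + m))) + (O + f (1 + (m + m)))
  ≡⟨ cong₂ (λ i s → (E + f i) + s) (sym (ℕ.+-suc (suc m) m))
           (sym (sumBelow-sucʳ m (λ k → f (suc (k + k))))) ⟩
    (E + f (suc m + suc m)) + sumBelow (suc m) (λ k → f (suc (k + k)))
  ≡⟨ cong (_+ sumBelow (suc m) (λ k → f (suc (k + k)))) (sym (sumBelow-sucʳ (suc m) (λ k → f (k + k)))) ⟩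
    sumBelow (suc (suc m)) (λ k → f (k + k)) + sumBelow (suc m) (λ k → f (suc (k + k)))
  ∎
  where
  E = sumBelow (suc m) (λ k → f (k + k))
  O = sumBelow m (λ k → f (suc (k + k)))
  regroup : ∀ a b c d → a + b + c + d ≡ (a + d) + (b + c)
  regroup = ℕ-Ring.solve-∀

Odd : ℕ → Set
Odd a = ∃[ m ] a ≡ suc (m + m)

Periodic : ℕ → (ℤ → ℕ) → Set
Periodic a H = ∀ z → H (z ℤ.+ + a) ≡ H z

sumBelow-translate : ∀ a {H} → Periodic a H → ∀ c →
  sumBelow a (λ k → H (+ k ℤ.+ c)) ≡ sumBelow a (H ∘ +_)
sumBelow-translate zero        per c = refl
sumBelow-translate (suc m) {H} per c =
  trans (shift c) (sumBelow-cong (suc m) (λ k → cong H (ℤ.+-identityʳ (+ k))))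
  where
  S : ℤ → ℕ
  S c = sumBelow (suc m) (λ k → H (+ k ℤ.+ c))

  S-suc : ∀ c → S (1ℤ ℤ.+ c) ≡ S c
  S-suc c = begin
      S (1ℤ ℤ.+ c)
    ≡⟨ sumBelow-sucʳ m _ ⟩
      sumBelow m (λ k → H (+ k ℤ.+ (1ℤ ℤ.+ c))) + H (+ m ℤ.+ (1ℤ ℤ.+ c))
    ≡⟨ cong₂ _+_ (sumBelow-cong m (λ k → cong H (shiftˡ (+ k) c)))
                 (trans (cong H (wrap (+ m) c)) (per (0ℤ ℤ.+ c))) ⟩
      sumBelow m (λ k → H (+ suc k ℤ.+ c)) + H (0ℤ ℤ.+ c)
    ≡⟨ ℕ.+-comm (sumBelow m (λ k → H (+ suc k ℤ.+ c))) (H (0ℤ ℤ.+ c)) ⟩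
      S c
    ∎
    where
    shiftˡ : ∀ k c → k ℤ.+ (1ℤ ℤ.+ c) ≡ (1ℤ ℤ.+ k) ℤ.+ c
    shiftˡ = solve-∀
    wrap : ∀ m c → m ℤ.+ (1ℤ ℤ.+ c) ≡ (0ℤ ℤ.+ c) ℤ.+ (1ℤ ℤ.+ m)
    wrap = solve-∀

  shift : ∀ c → S c ≡ S 0ℤ
  shift (+ zero)       = refl
  shift (+ suc n)      = trans (S-suc (+ n)) (shift (+ n))
  shift -[1+ zero ]    = sym (S-suc -[1+ zero ])
  shift -[1+ suc n ]   = trans (sym (S-suc -[1+ suc n ])) (shift -[1+ n ])

-- The even multiples 2k with k ≤ m are 0,2,…,2m; the remaining 2k are the odd residues shifted by a.
sumBelow-double : ∀ {a H} → Odd a → Periodic a H →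
  sumBelow a (λ k → H (+ 2 ℤ.* + k)) ≡ sumBelow a (H ∘ +_)
sumBelow-double {H = H} (m , refl) per = begin
    sumBelow (suc m + m) (λ k → H (+ 2 ℤ.* + k))
  ≡⟨ sumBelow-+-range (suc m) m (λ k → H (+ 2 ℤ.* + k)) ⟩
    sumBelow (suc m) (λ k → H (+ 2 ℤ.* + k)) + sumBelow m (λ j → H (+ 2 ℤ.* + (suc m + j)))
  ≡⟨ cong₂ _+_ (sumBelow-cong (suc m) (cong H ∘ evens))
               (sumBelow-cong m (λ j → trans (cong H (odds j)) (per (+ suc (j + j))))) ⟩
    sumBelow (suc m) (λ k → H (+ (k + k))) + sumBelow m (λ j → H (+ suc (j + j)))
  ≡⟨ sym (sumBelow-evenOdd m (H ∘ +_)) ⟩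
    sumBelow (suc (m + m)) (H ∘ +_)
  ∎
  where
  evens : ∀ k → + 2 ℤ.* + k ≡ + (k + k)
  evens k = trans (sym (ℤ.pos-* 2 k)) (cong +_ (twice k))
    where twice : ∀ k → 2 * k ≡ k + k
          twice = ℕ-Ring.solve-∀
  odds : ∀ j → + 2 ℤ.* + (suc m + j) ≡ + suc (j + j) ℤ.+ + suc (m + m)
  odds j = trans (sym (ℤ.pos-* 2 (suc m + j)))
                 (trans (cong +_ (twice m j)) (ℤ.pos-+ (suc (j + j)) (suc (m + m))))
    where twice : ∀ m j → 2 * (suc m + j) ≡ suc (j + j) + suc (m + m)
          twice = ℕ-Ring.solve-∀

-- `x ≡ y [mod m ]` unfolds to `m ∣ ∣ x - y ∣`; phrasing the next lemmas through the difference D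
-- lets Agda infer it at the use sites.
∣-shift : ∀ {m D D′} → + m ∣ D ℤ.- D′ → m ℕᵈ.∣ ∣ D ∣ → m ℕᵈ.∣ ∣ D′ ∣
∣-shift {m} {D} {D′} d m∣D =
  ∣⇒∣ᵤ (subst (+ m ∣_) (cancel D D′) (∣m∣n⇒∣m-n (∣ᵤ⇒∣ {+ m} {D} m∣D) d))
  where
  cancel : ∀ u v → u ℤ.- (u ℤ.- v) ≡ v
  cancel = solve-∀

does-∣?-≡ : ∀ m {D D′} → D ≡ D′ → does (m ℕᵈ.∣? ∣ D ∣) ≡ does (m ℕᵈ.∣? ∣ D′ ∣)
does-∣?-≡ m = cong (λ z → does (m ℕᵈ.∣? ∣ z ∣))

does-∣?-∣ : ∀ {m D D′} → + m ∣ D ℤ.- D′ → does (m ℕᵈ.∣? ∣ D ∣) ≡ does (m ℕᵈ.∣? ∣ D′ ∣)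
does-∣?-∣ {m} {D} {D′} d =
  does-⇔ (mk⇔ (∣-shift {m} {D} {D′} d) (∣-shift {m} {D′} {D} (subst (+ m ∣_) (flip D D′) (∣m⇒∣-m d))))
         (m ℕᵈ.∣? ∣ D ∣) (m ℕᵈ.∣? ∣ D′ ∣)
  where
  flip : ∀ u v → ℤ.- (u ℤ.- v) ≡ v ℤ.- u
  flip = solve-∀

module _ {A : Set} {P : Pred A 0ℓ} (P? : Decidable P) where

  count-cong : {Q : Pred A 0ℓ} (Q? : Decidable Q) → (∀ x → does (P? x) ≡ does (Q? x)) →
    ∀ xs → length (filter P? xs) ≡ length (filter Q? xs)
  count-cong Q? P≡Q [] = refl
  count-cong Q? P≡Q (x ∷ xs) with does (P? x) | does (Q? x) | P≡Q x
  ... | true  | .true  | refl = cong suc (count-cong Q? P≡Q xs)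
  ... | false | .false | refl = count-cong Q? P≡Q xs

  count-singleton : ∀ x → length (filter P? (x ∷ [])) ≡ (if does (P? x) then 1 else 0)
  count-singleton x with does (P? x)
  ... | true  = refl
  ... | false = refl

  count-map : ∀ {B : Set} (f : B → A) xs → length (filter P? (map f xs)) ≡ length (filter (P? ∘ f) xs)
  count-map f [] = refl
  count-map f (x ∷ xs) with does (P? (f x))
  ... | true  = cong suc (count-map f xs)
  ... | false = count-map f xs

module _ {A : Set} (m : ℕ) {D D′ : A → ℤ} where

  count-∣?-∣ : (∀ x → + m ∣ D x ℤ.- D′ x) → ∀ xs →
    length (filter (λ x → m ℕᵈ.∣? ∣ D x ∣) xs) ≡ length (filter (λ x → m ℕᵈ.∣? ∣ D′ x ∣) xs)
  count-∣?-∣ d = count-cong _ _ (λ x → does-∣?-∣ {m} {D x} {D′ x} (d x))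

  count-∣?-≡ : (∀ x → D x ≡ D′ x) → ∀ xs →
    length (filter (λ x → m ℕᵈ.∣? ∣ D x ∣) xs) ≡ length (filter (λ x → m ℕᵈ.∣? ∣ D′ x ∣) xs)
  count-∣?-≡ e = count-cong _ _ (λ x → does-∣?-≡ m (e x))

count-allVecs-suc : ∀ {N} {P : Pred (Vec ℕ (suc N)) 0ℓ} (P? : Decidable P) a →
  length (filter P? (allVecs a (suc N))) ≡ sumBelow a (λ k → length (filter (P? ∘ (k ∷_)) (allVecs a N)))
count-allVecs-suc {N} P? a = trans (byHead (upTo a)) (sum-map-applyUpTo _ id a)
  where
  byHead : ∀ ks → length (filter P? (concatMap (λ k → map (k ∷_) (allVecs a N)) ks))
                  ≡ sum (map (λ k → length (filter (P? ∘ (k ∷_)) (allVecs a N))) ks)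
  byHead []       = refl
  byHead (k ∷ ks) = begin
      length (filter P? (map (k ∷_) (allVecs a N) ++ rest))
    ≡⟨ cong length (filter-++ P? (map (k ∷_) (allVecs a N)) rest) ⟩
      length (filter P? (map (k ∷_) (allVecs a N)) ++ filter P? rest)
    ≡⟨ length-++ (filter P? (map (k ∷_) (allVecs a N))) ⟩
      length (filter P? (map (k ∷_) (allVecs a N))) + length (filter P? rest)
    ≡⟨ cong₂ _+_ (count-map P? (k ∷_) (allVecs a N)) (byHead ks) ⟩
      sum (map (λ k → length (filter (P? ∘ (k ∷_)) (allVecs a N))) (k ∷ ks))
    ∎
    where rest = concatMap (λ k → map (k ∷_) (allVecs a N)) ks

binomialSumMod : ℕ → ℕ → ℤ → ℕ
binomialSumMod m N s = sumBelow (suc N) (λ j → if does ((+ j) ≡? s [mod m ]) then N C j else 0)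

ω≡binomialSumMod : ∀ N D → ω N D ≡ binomialSumMod 4 N (ℤ.- D)
ω≡binomialSumMod N D = trans (sum-filter (upTo (suc N))) (sum-map-applyUpTo _ id (suc N))
  where
  sum-filter : ∀ js → sum (map (N C_) (filter (λ j → (+ j) ≡? ℤ.- D [mod 4 ]) js))
                      ≡ sum (map (λ j → if does ((+ j) ≡? ℤ.- D [mod 4 ]) then N C j else 0) js)
  sum-filter []       = refl
  sum-filter (j ∷ js) with does ((+ j) ≡? ℤ.- D [mod 4 ])
  ... | true  = cong (_+_ (N C j)) (sum-filter js)
  ... | false = sum-filter js

binomialSumMod-suc : ∀ m N s →
  binomialSumMod m (suc N) s ≡ binomialSumMod m N s + binomialSumMod m N (s ℤ.- 1ℤ)
binomialSumMod-suc m N s = begin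
    t 0 + sumBelow (suc N) (λ j → term (suc N) s (suc j))
  ≡⟨ cong (_+_ (t 0)) (sumBelow-cong (suc N) pascal) ⟩
    t 0 + sumBelow (suc N) (λ j → u j + t (suc j))
  ≡⟨ cong (_+_ (t 0)) (sumBelow-+ (suc N) u (t ∘ suc)) ⟩
    t 0 + (binomialSumMod m N (s ℤ.- 1ℤ) + sumBelow (suc N) (t ∘ suc))
  ≡⟨ swap (t 0) _ _ ⟩
    sumBelow (suc (suc N)) t + binomialSumMod m N (s ℤ.- 1ℤ)
  ≡⟨ cong (_+ binomialSumMod m N (s ℤ.- 1ℤ)) (sumBelow-sucʳ (suc N) t) ⟩
    binomialSumMod m N s + t (suc N) + binomialSumMod m N (s ℤ.- 1ℤ)
  ≡⟨ cong (λ z → binomialSumMod m N s + z + binomialSumMod m N (s ℤ.- 1ℤ)) t[N+1]≡0 ⟩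
    binomialSumMod m N s + 0 + binomialSumMod m N (s ℤ.- 1ℤ)
  ≡⟨ cong (_+ binomialSumMod m N (s ℤ.- 1ℤ)) (ℕ.+-identityʳ (binomialSumMod m N s)) ⟩
    binomialSumMod m N s + binomialSumMod m N (s ℤ.- 1ℤ)
  ∎
  where
  term : ℕ → ℤ → ℕ → ℕ
  term N s j = if does ((+ j) ≡? s [mod m ]) then N C j else 0
  t = term N s
  u = term N (s ℤ.- 1ℤ)

  swap : ∀ a b c → a + (b + c) ≡ a + c + b
  swap = ℕ-Ring.solve-∀

  t[N+1]≡0 : t (suc N) ≡ 0
  t[N+1]≡0 = trans (cong (λ c → if does ((+ suc N) ≡? s [mod m ]) then c else 0) (k>n⇒nCk≡0 (ℕ.n<1+n N)))
                   (if-eta (does ((+ suc N) ≡? s [mod m ])))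

  lower : ∀ j s → (1ℤ ℤ.+ j) ℤ.- s ≡ j ℤ.- (s ℤ.- 1ℤ)
  lower = solve-∀

  pascal : ∀ j → term (suc N) s (suc j) ≡ u j + t (suc j)
  pascal j rewrite does-∣?-≡ m (lower (+ j) s)
    with does ((+ j) ≡? s ℤ.- 1ℤ [mod m ])
  ... | true  = sym (nCk+nC[k+1]≡[n+1]C[k+1] N j)
  ... | false = refl

binomialSumMod-reflect : ∀ m N s → binomialSumMod m N s ≡ binomialSumMod m N (+ N ℤ.- s)
binomialSumMod-reflect m zero s =
  cong (λ c → (if c then 1 else 0) + 0)
       (cong (λ z → does (m ℕᵈ.∣? z))
         (trans (cong ∣_∣ (ℤ.+-identityˡ (ℤ.- s))) (trans (ℤ.∣-i∣≡∣i∣ s) (cong ∣_∣ (negate-twice s)))))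
  where
  negate-twice : ∀ s → s ≡ 0ℤ ℤ.- (0ℤ ℤ.- s)
  negate-twice = solve-∀
binomialSumMod-reflect m (suc N) s = begin
    binomialSumMod m (suc N) s
  ≡⟨ binomialSumMod-suc m N s ⟩
    B s + B (s ℤ.- 1ℤ)
  ≡⟨ cong₂ _+_ (binomialSumMod-reflect m N s) (binomialSumMod-reflect m N (s ℤ.- 1ℤ)) ⟩
    B (+ N ℤ.- s) + B (+ N ℤ.- (s ℤ.- 1ℤ))
  ≡⟨ ℕ.+-comm (B (+ N ℤ.- s)) (B (+ N ℤ.- (s ℤ.- 1ℤ))) ⟩
    B (+ N ℤ.- (s ℤ.- 1ℤ)) + B (+ N ℤ.- s)
  ≡⟨ cong₂ (λ u v → B u + B v) (first (+ N) s) (second (+ N) s) ⟩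
    B (+ suc N ℤ.- s) + B ((+ suc N ℤ.- s) ℤ.- 1ℤ)
  ≡⟨ sym (binomialSumMod-suc m N (+ suc N ℤ.- s)) ⟩
    binomialSumMod m (suc N) (+ suc N ℤ.- s)
  ∎
  where
  B = binomialSumMod m N
  first : ∀ n s → n ℤ.- (s ℤ.- 1ℤ) ≡ (1ℤ ℤ.+ n) ℤ.- s
  first = solve-∀
  second : ∀ n s → n ℤ.- s ≡ ((1ℤ ℤ.+ n) ℤ.- s) ℤ.- 1ℤ
  second = solve-∀

binomialSumMod-cong : ∀ m N {s s′} → + m ∣ s ℤ.- s′ → binomialSumMod m N s ≡ binomialSumMod m N s′
binomialSumMod-cong m N {s} {s′} m∣s-s′ = sumBelow-cong (suc N) λ j →
  cong (λ c → if c then N C j else 0)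
       (does-∣?-∣ {D = (+ j) ℤ.- s} (subst (+ m ∣_) (flip (+ j) s s′) (∣m⇒∣-m m∣s-s′)))
  where
  flip : ∀ j s s′ → ℤ.- (s ℤ.- s′) ≡ (j ℤ.- s) ℤ.- (j ℤ.- s′)
  flip = solve-∀

evenIndicator : ℤ → ℤ
evenIndicator l = if does (evenℤ? l) then 1ℤ else 0ℤ

-- the sign with which σᵢ enters Σ_{i∉J} σᵢ − Σ_{i∈J} σᵢ when λᵢ = l
paritySign : ℤ → ℤ
paritySign l = if does (evenℤ? l) then -1ℤ else 1ℤ

evenCount : ∀ {N} → Vec ℤ N → ℤ
evenCount []       = 0ℤ
evenCount (l ∷ ls) = evenIndicator l ℤ.+ evenCount ls

signedWeightCount : ∀ {N} → ℕ → Vec ℤ N → ℤ → ℕ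
signedWeightCount {N} m λ' t =
  length (filter (λ σ → (+ sumNotInJ λ' σ) ≡? (+ sumInJ λ' σ) ℤ.+ t [mod m ]) (allVecs 2 N))

signedWeight-∷ : ∀ {N} l s (ls : Vec ℤ N) σ t →
  (+ sumNotInJ (l ∷ ls) (s ∷ σ)) ℤ.- ((+ sumInJ (l ∷ ls) (s ∷ σ)) ℤ.+ t)
  ≡ (+ sumNotInJ ls σ) ℤ.- ((+ sumInJ ls σ) ℤ.+ (t ℤ.- + s ℤ.* paritySign l))
signedWeight-∷ l s ls σ t with does (evenℤ? l)
... | true  = inJ (+ sumNotInJ ls σ) (+ s) (+ sumInJ ls σ) t
  where inJ : ∀ a s b t → a ℤ.- ((s ℤ.+ b) ℤ.+ t) ≡ a ℤ.- (b ℤ.+ (t ℤ.- s ℤ.* -1ℤ))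
        inJ = solve-∀
... | false = notInJ (+ s) (+ sumNotInJ ls σ) (+ sumInJ ls σ) t
  where notInJ : ∀ s a b t → (s ℤ.+ a) ℤ.- (b ℤ.+ t) ≡ a ℤ.- (b ℤ.+ (t ℤ.- s ℤ.* 1ℤ))
        notInJ = solve-∀

signedWeightCount-∷ : ∀ {N} m l (ls : Vec ℤ N) t →
  signedWeightCount m (l ∷ ls) t ≡ signedWeightCount m ls t + signedWeightCount m ls (t ℤ.- paritySign l)
signedWeightCount-∷ {N} m l ls t = begin
    signedWeightCount m (l ∷ ls) t
  ≡⟨ count-allVecs-suc P? 2 ⟩
    withHead 0 + (withHead 1 + 0)
  ≡⟨ cong₂ (λ u v → u + (v + 0)) (withHead≡ 0 (σ₀=0 t (paritySign l)))
                                 (withHead≡ 1 (σ₀=1 t (paritySign l))) ⟩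
    signedWeightCount m ls t + (signedWeightCount m ls (t ℤ.- paritySign l) + 0)
  ≡⟨ cong (_+_ (signedWeightCount m ls t)) (ℕ.+-identityʳ _) ⟩
    signedWeightCount m ls t + signedWeightCount m ls (t ℤ.- paritySign l)
  ∎
  where
  P? = λ σ → (+ sumNotInJ (l ∷ ls) σ) ≡? (+ sumInJ (l ∷ ls) σ) ℤ.+ t [mod m ]
  withHead = λ s → length (filter (P? ∘ (s ∷_)) (allVecs 2 N))

  withHead≡ : ∀ s {t′} → t ℤ.- + s ℤ.* paritySign l ≡ t′ → withHead s ≡ signedWeightCount m ls t′
  withHead≡ s refl = count-∣?-≡ m (λ σ → signedWeight-∷ l s ls σ t) (allVecs 2 N)

  σ₀=0 : ∀ t e → t ℤ.- 0ℤ ℤ.* e ≡ t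
  σ₀=0 = solve-∀
  σ₀=1 : ∀ t e → t ℤ.- 1ℤ ℤ.* e ≡ t ℤ.- e
  σ₀=1 = solve-∀

signedWeightCount≡binomialSumMod : ∀ {N} m (λ' : Vec ℤ N) t →
  signedWeightCount m λ' t ≡ binomialSumMod m N (t ℤ.+ evenCount λ')
signedWeightCount≡binomialSumMod m [] t = begin
    signedWeightCount m [] t
  ≡⟨ count-singleton (λ σ → (+ sumNotInJ [] σ) ≡? (+ sumInJ [] σ) ℤ.+ t [mod m ]) [] ⟩
    (if does ((+ 0) ≡? (+ 0) ℤ.+ t [mod m ]) then 1 else 0)
  ≡⟨ cong (λ c → if c then 1 else 0) (does-∣?-≡ m (cong (ℤ._-_ 0ℤ) (ℤ.+-comm 0ℤ t))) ⟩
    (if does ((+ 0) ≡? t ℤ.+ 0ℤ [mod m ]) then 1 else 0)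
  ≡⟨ ℕ.+-identityʳ _ ⟨
    binomialSumMod m 0 (t ℤ.+ 0ℤ)
  ∎
signedWeightCount≡binomialSumMod {suc N} m (l ∷ ls) t = begin
    signedWeightCount m (l ∷ ls) t
  ≡⟨ signedWeightCount-∷ m l ls t ⟩
    signedWeightCount m ls t + signedWeightCount m ls (t ℤ.- paritySign l)
  ≡⟨ cong₂ _+_ (signedWeightCount≡binomialSumMod m ls t)
               (signedWeightCount≡binomialSumMod m ls (t ℤ.- paritySign l)) ⟩
    B (t ℤ.+ evenCount ls) + B ((t ℤ.- paritySign l) ℤ.+ evenCount ls)
  ≡⟨ pascal ⟩
    binomialSumMod m (suc N) (t ℤ.+ evenCount (l ∷ ls))
  ∎
  where
  B = binomialSumMod m N
  pascal : B (t ℤ.+ evenCount ls) + B ((t ℤ.- paritySign l) ℤ.+ evenCount ls)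
           ≡ binomialSumMod m (suc N) (t ℤ.+ evenCount (l ∷ ls))
  pascal with does (evenℤ? l)
  ... | true  = begin
      B (t ℤ.+ e) + B ((t ℤ.- -1ℤ) ℤ.+ e)
    ≡⟨ ℕ.+-comm (B (t ℤ.+ e)) _ ⟩
      B ((t ℤ.- -1ℤ) ℤ.+ e) + B (t ℤ.+ e)
    ≡⟨ cong₂ (λ u v → B u + B v) (up t e) (down t e) ⟩
      B (t ℤ.+ (1ℤ ℤ.+ e)) + B ((t ℤ.+ (1ℤ ℤ.+ e)) ℤ.- 1ℤ)
    ≡⟨ binomialSumMod-suc m N (t ℤ.+ (1ℤ ℤ.+ e)) ⟨
      binomialSumMod m (suc N) (t ℤ.+ (1ℤ ℤ.+ e))
    ∎
    where
    e = evenCount ls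
    up : ∀ t e → (t ℤ.- -1ℤ) ℤ.+ e ≡ t ℤ.+ (1ℤ ℤ.+ e)
    up = solve-∀
    down : ∀ t e → t ℤ.+ e ≡ (t ℤ.+ (1ℤ ℤ.+ e)) ℤ.- 1ℤ
    down = solve-∀
  ... | false = begin
      B (t ℤ.+ e) + B ((t ℤ.- 1ℤ) ℤ.+ e)
    ≡⟨ cong (λ u → B (t ℤ.+ e) + B u) (down t e) ⟩
      B (t ℤ.+ e) + B ((t ℤ.+ e) ℤ.- 1ℤ)
    ≡⟨ binomialSumMod-suc m N (t ℤ.+ e) ⟨
      binomialSumMod m (suc N) (t ℤ.+ e)
    ≡⟨ cong (λ u → binomialSumMod m (suc N) (t ℤ.+ u)) (ℤ.+-identityˡ e) ⟨
      binomialSumMod m (suc N) (t ℤ.+ (0ℤ ℤ.+ e))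
    ∎
    where
    e = evenCount ls
    down : ∀ t e → (t ℤ.- 1ℤ) ℤ.+ e ≡ (t ℤ.+ e) ℤ.- 1ℤ
    down = solve-∀

square≡[mod4] : ∀ l → + 4 ∣ l ℤ.* l ℤ.- (1ℤ ℤ.- evenIndicator l)
square≡[mod4] l = byParity (evenℤ? l)
  where
  byParity : (even? : Dec (l ≡ + 0 [mod 2 ])) → + 4 ∣ l ℤ.* l ℤ.- (1ℤ ℤ.- (if does even? then 1ℤ else 0ℤ))
  byParity (yes 2∣l) with ∣ᵤ⇒∣ {+ 2} {l ℤ.- + 0} 2∣l
  ... | divides k l-0≡k*2 =
    divides (k ℤ.* k) (trans (cong (λ z → z ℤ.* z ℤ.- 0ℤ) (trans (sym (ℤ.+-identityʳ l)) l-0≡k*2)) (even k))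
    where
    even : ∀ k → (k ℤ.* + 2) ℤ.* (k ℤ.* + 2) ℤ.- 0ℤ ≡ (k ℤ.* k) ℤ.* + 4
    even = solve-∀
  byParity (no 2∤l) with l ℤ.% + 2 | a≡a%n+[a/n]*n l (+ 2) | n%d<d l (+ 2)
  ... | 0 | l≡[l/2]*2 | _ =
    ⊥-elim (2∤l (∣⇒∣ᵤ {+ 2} {l ℤ.- + 0}
      (divides (l ℤ./ + 2) (trans (ℤ.+-identityʳ l) (trans l≡[l/2]*2 (ℤ.+-identityˡ _))))))
  ... | 1 | l≡1+[l/2]*2 | _ =
    divides (k ℤ.* k ℤ.+ k) (trans (cong (λ z → z ℤ.* z ℤ.- 1ℤ) l≡1+[l/2]*2) (odd k))
    where
    k = l ℤ./ + 2
    odd : ∀ k → (1ℤ ℤ.+ k ℤ.* + 2) ℤ.* (1ℤ ℤ.+ k ℤ.* + 2) ℤ.- 1ℤ ≡ (k ℤ.* k ℤ.+ k) ℤ.* + 4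
    odd = solve-∀
  ... | suc (suc _) | _ | s≤s (s≤s ())

q≡[mod4] : ∀ {N} (λ' : Vec ℤ N) → + 4 ∣ q λ' ℤ.- (+ N ℤ.- evenCount λ')
q≡[mod4] []               = divides 0ℤ refl
q≡[mod4] {suc N} (l ∷ ls) =
  subst (+ 4 ∣_) (regroup (l ℤ.* l) (evenIndicator l) (q ls) (+ N) (evenCount ls))
        (∣m∣n⇒∣m+n (square≡[mod4] l) (q≡[mod4] ls))
  where
  regroup : ∀ s i Q n e →
    (s ℤ.- (1ℤ ℤ.- i)) ℤ.+ (Q ℤ.- (n ℤ.- e)) ≡ (s ℤ.+ Q) ℤ.- ((1ℤ ℤ.+ n) ℤ.- (i ℤ.+ e))
  regroup = solve-∀

α≡ω : ∀ {N} n (λ' : Vec ℤ N) → α λ' ≡ ω N (Δ n λ')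
α≡ω {N} n λ' = begin
    α λ'
  ≡⟨ count-∣?-≡ 4 (λ σ → cong (ℤ._-_ (+ sumNotInJ λ' σ)) (sym (ℤ.+-identityʳ (+ sumInJ λ' σ))))
                  (allVecs 2 N) ⟩
    signedWeightCount 4 λ' 0ℤ
  ≡⟨ signedWeightCount≡binomialSumMod 4 λ' 0ℤ ⟩
    binomialSumMod 4 N (0ℤ ℤ.+ evenCount λ')
  ≡⟨ binomialSumMod-reflect 4 N (0ℤ ℤ.+ evenCount λ') ⟩
    binomialSumMod 4 N (+ N ℤ.- (0ℤ ℤ.+ evenCount λ'))
  ≡⟨ binomialSumMod-cong 4 N {+ N ℤ.- (0ℤ ℤ.+ evenCount λ')} { - Δ n λ' } 4∣N-#J+Δ ⟩
    binomialSumMod 4 N (- Δ n λ')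
  ≡⟨ ω≡binomialSumMod N (Δ n λ') ⟨
    ω N (Δ n λ')
  ∎
  where
  regroup : ∀ N e Q n →
    ℤ.- (Q ℤ.- (N ℤ.- e)) ℤ.+ n ℤ.* + 4 ≡ (N ℤ.- (0ℤ ℤ.+ e)) ℤ.- (ℤ.- (+ 4 ℤ.* n ℤ.- Q))
  regroup = solve-∀
  4∣N-#J+Δ : + 4 ∣ (+ N ℤ.- (0ℤ ℤ.+ evenCount λ')) ℤ.- (- Δ n λ')
  4∣N-#J+Δ = subst (+ 4 ∣_) (regroup (+ N) (evenCount λ') (q λ') n)
                   (∣m∣n⇒∣m+n (∣m⇒∣-m (q≡[mod4] λ')) (divides n refl))

-- a² = 4(m² + m) + 1, so 4 ∣ y·a² forces 4 ∣ y.
4∣∧odd∣⇒4*odd∣ : ∀ {a z} → Odd a → 4 ℕᵈ.∣ z → a ℕᵈ.∣ z → 4 * a ℕᵈ.∣ z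
4∣∧odd∣⇒4*odd∣ {a} (m , refl) 4∣z (ℕᵈ.divides y z≡y*a) =
  subst (4 * a ℕᵈ.∣_) (sym z≡y*a) (ℕᵈ.*-monoˡ-∣ a 4∣y)
  where
  square : ∀ y m → y * suc (m + m) * suc (m + m) ≡ 4 * (y * (m * m + m)) + y
  square = ℕ-Ring.solve-∀
  4∣y : 4 ℕᵈ.∣ y
  4∣y = ℕᵈ.∣m+n∣m⇒∣n (subst (4 ℕᵈ.∣_) (square y m) (ℕᵈ.∣m⇒∣m*n a (subst (4 ℕᵈ.∣_) z≡y*a 4∣z)))
                     (ℕᵈ.m∣m*n (y * (m * m + m)))

≡[mod4*odd]⇔≡[mod-odd] : ∀ {a x y} → Odd a → x ≡ y [mod 4 ] → x ≡ y [mod 4 * a ] ⇔ x ≡ y [mod a ]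
≡[mod4*odd]⇔≡[mod-odd] odd 4∣x-y = mk⇔ (ℕᵈ.∣-trans (ℕᵈ.n∣m*n 4)) (4∣∧odd∣⇒4*odd∣ odd 4∣x-y)

peelSquare : ∀ y Q T → (y ℤ.* y ℤ.+ Q) ℤ.- T ≡ Q ℤ.- (T ℤ.- y ℤ.* y)
peelSquare = solve-∀

𝔇-∷ : ∀ a {N} l (λ' : Vec ℤ N) T →
  𝔇 a (l ∷ λ') T ≡ sumBelow a (λ k → 𝔇 a λ' (T ℤ.- (+ 2 ℤ.* + k ℤ.- l) ℤ.* (+ 2 ℤ.* + k ℤ.- l)))
𝔇-∷ a {N} l λ' T =
  trans (count-allVecs-suc _ a)
        (sumBelow-cong a λ k → count-∣?-≡ (4 * a) (λ x → peelSquare (+ 2 ℤ.* + k ℤ.- l) _ T) (allVecs a N))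

A-suc : ∀ a N T → A (suc N) T a ≡ sumBelow a (λ k → A N (T ℤ.- + k ℤ.* + k) a)
A-suc a N T =
  trans (count-allVecs-suc _ a)
        (sumBelow-cong a λ k → count-∣?-≡ a (λ x → peelSquare (+ k) _ T) (allVecs a N))

A-periodic : ∀ a N T → Periodic a (λ z → A N (T ℤ.- z ℤ.* z) a)
A-periodic a N T z =
  count-∣?-∣ a {λ x → Q x ℤ.- (T ℤ.- (z ℤ.+ + a) ℤ.* (z ℤ.+ + a))} {λ x → Q x ℤ.- (T ℤ.- z ℤ.* z)}
             (λ x → divides (+ 2 ℤ.* z ℤ.+ + a) (expand (Q x) T z (+ a))) (allVecs a N)
  where
  Q : Vec ℕ N → ℤ
  Q x = q (Vec.map +_ x)
  expand : ∀ Q T z a →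
    (Q ℤ.- (T ℤ.- (z ℤ.+ a) ℤ.* (z ℤ.+ a))) ℤ.- (Q ℤ.- (T ℤ.- z ℤ.* z)) ≡ (+ 2 ℤ.* z ℤ.+ a) ℤ.* a
  expand = solve-∀

sumBelow-affine : ∀ {a H} → Odd a → Periodic a H → ∀ l →
  sumBelow a (λ k → H (+ 2 ℤ.* + k ℤ.- l)) ≡ sumBelow a (H ∘ +_)
sumBelow-affine {a} {H} odd per l = trans (sumBelow-double odd per-l) (sumBelow-translate a per (ℤ.- l))
  where
  per-l : Periodic a (λ z → H (z ℤ.- l))
  per-l z = trans (cong H (swap z (+ a) l)) (per (z ℤ.- l))
    where swap : ∀ z a l → (z ℤ.+ a) ℤ.- l ≡ (z ℤ.- l) ℤ.+ a
          swap = solve-∀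

𝔇≡A : ∀ {a N} → Odd a → (λ' : Vec ℤ N) (T : ℤ) → q λ' ≡ T [mod 4 ] → 𝔇 a λ' T ≡ A N T a
𝔇≡A {a} odd [] T 0≡T = begin
    𝔇 a [] T
  ≡⟨ count-singleton (λ x → q (zipWith (λ xi li → + 2 ℤ.* + xi ℤ.- li) x []) ≡? T [mod 4 * a ]) [] ⟩
    (if does ((+ 0) ≡? T [mod 4 * a ]) then 1 else 0)
  ≡⟨ cong (λ c → if c then 1 else 0)
          (does-⇔ (≡[mod4*odd]⇔≡[mod-odd] {x = + 0} {T} odd 0≡T)
                  ((+ 0) ≡? T [mod 4 * a ]) ((+ 0) ≡? T [mod a ])) ⟩
    (if does ((+ 0) ≡? T [mod a ]) then 1 else 0)
  ≡⟨ count-singleton (λ x → q (Vec.map +_ x) ≡? T [mod a ]) [] ⟨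
    A 0 T a
  ∎
𝔇≡A {a} {suc N} odd (l ∷ λ') T q≡T = begin
    𝔇 a (l ∷ λ') T
  ≡⟨ 𝔇-∷ a l λ' T ⟩
    sumBelow a (λ k → 𝔇 a λ' (T ℤ.- (+ 2 ℤ.* + k ℤ.- l) ℤ.* (+ 2 ℤ.* + k ℤ.- l)))
  ≡⟨ sumBelow-cong a (λ k → 𝔇≡A odd λ' _ (q≡T-[2k-l]² k)) ⟩
    sumBelow a (λ k → H (+ 2 ℤ.* + k ℤ.- l))
  ≡⟨ sumBelow-affine odd (A-periodic a N T) l ⟩
    sumBelow a (H ∘ +_)
  ≡⟨ A-suc a N T ⟨
    A (suc N) T a
  ∎
  where
  H : ℤ → ℕ
  H z = A N (T ℤ.- z ℤ.* z) a
  cross : ∀ Q T l k →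
    ((l ℤ.* l ℤ.+ Q) ℤ.- T) ℤ.- (Q ℤ.- (T ℤ.- (+ 2 ℤ.* k ℤ.- l) ℤ.* (+ 2 ℤ.* k ℤ.- l)))
    ≡ (k ℤ.* l ℤ.- k ℤ.* k) ℤ.* + 4
  cross = solve-∀
  q≡T-[2k-l]² : ∀ k → q λ' ≡ T ℤ.- (+ 2 ℤ.* + k ℤ.- l) ℤ.* (+ 2 ℤ.* + k ℤ.- l) [mod 4 ]
  q≡T-[2k-l]² k =
    ∣-shift {4} {q (l ∷ λ') ℤ.- T} {q λ' ℤ.- (T ℤ.- (+ 2 ℤ.* + k ℤ.- l) ℤ.* (+ 2 ℤ.* + k ℤ.- l))}
            (divides (+ k ℤ.* l ℤ.- + k ℤ.* + k) (cross (q λ') T l (+ k))) q≡T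

odd-* : ∀ {a b} → Odd a → Odd b → Odd (a * b)
odd-* (m , refl) (n , refl) = m + n + 2 * m * n , expand m n
  where
  expand : ∀ m n → suc (m + m) * suc (n + n) ≡ suc ((m + n + 2 * m * n) + (m + n + 2 * m * n))
  expand = ℕ-Ring.solve-∀

odd-^ : ∀ {a} → Odd a → ∀ l → Odd (a ^ l)
odd-^ odd zero    = 0 , refl
odd-^ odd (suc l) = odd-* odd (odd-^ odd l)

prime≢2⇒odd : ∀ {p} → Prime p → p ≢ 2 → Odd p
prime≢2⇒odd {p} p-prime p≢2 = byRemainder (p % 2) (m≡m%n+[m/n]*n p 2) (m%n<n p 2)
  where
  byRemainder : ∀ r → p ≡ r + p / 2 * 2 → r < 2 → Odd p
  byRemainder zero p≡[p/2]*2 _ with prime⇒irreducible p-prime (ℕᵈ.divides (p / 2) p≡[p/2]*2)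
  ... | inj₁ ()
  ... | inj₂ 2≡p = ⊥-elim (p≢2 (sym 2≡p))
  byRemainder (suc zero) p≡1+[p/2]*2 _ = p / 2 , trans p≡1+[p/2]*2 (halve (p / 2))
    where halve : ∀ k → 1 + k * 2 ≡ suc (k + k)
          halve = ℕ-Ring.solve-∀
  byRemainder (suc (suc r)) _ (s≤s (s≤s ()))

lemma4p1 : (N : ℕ) → N ≥ 1 → (p : ℕ) → Prime p → p ≢ 2 →
    (n : ℤ) (λ' : Vec ℤ N) (l : ℕ) →
    α λ' * 𝔇 (p ^ l) λ' (- Δ n λ') ≡ ω N (Δ n λ') * A N (- Δ n λ') (p ^ l)
lemma4p1 N _ p p-prime p≢2 n λ' l =
  cong₂ _*_ (α≡ω n λ') (𝔇≡A (odd-^ (prime≢2⇒odd p-prime p≢2) l) λ' (- Δ n λ') q≡-Δ)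
  where
  difference : ∀ Q n → Q ℤ.- (ℤ.- (+ 4 ℤ.* n ℤ.- Q)) ≡ n ℤ.* + 4
  difference = solve-∀
  q≡-Δ : q λ' ≡ - Δ n λ' [mod 4 ]
  q≡-Δ = ∣⇒∣ᵤ (divides n (difference (q λ') n))
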